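{- Let $q$ be a power of $2$, let $\Sigma$ (viewed as a point set) be as defined below, and let $\ell$ be the line $X=0$. Then for every point $x$ of $\mathrm{PG}(2,q^2)$, \[|x^\perp\cap\Sigma|=\begin{cases}\frac{q^2-q}{2} & \text{if } x\in\Sigma,\\ \frac{q^2+q}{2} & \text{if } x\in\mathrm{PG}(2,q^2)\setminus(\Sigma\cup\ell),\\ \frac{q^2}{2} & \text{if } x\in\ell\setminus\{U_2\},\\ 0 & \text{if } x=U_2.\end{cases}\]
   Context: In $\mathrm{PG}(2,q^2)$ (homogeneous coordinates over $\mathbb{F}_{q^2}$) consider the unitary polarity $(x,y,z)^\perp=[y^q,x^q,z^q]$, where $[a,b,c]$ is the line $aX+bY+cZ=0$. Let $U_2=(0,1,0)$ (so $U_2^\perp$ is the line $X=0$) and for $\lambda\in\mathbb{F}_q$ let $\mathcal{U}_\lambda$ be the Hermitian curve $\lambda X^{q+1}+X^qY+XY^q+Z^{q+1}=0$. Let $H$ be an additive subgroup of $\mathbb{F}_q$ of order $q/2$ with $1\notin H$, let $\Lambda=\{(h+1)^{ -1}: h\in H\}$, and let $\Sigma=\bigcup_{\lambda\in\Lambda}\mathcal{U}_\lambda\setminus\{U_2\}$. -}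

module Defs where

open import Level using (0ℓ)
open import Data.Nat using (ℕ; zero; suc)
open import Data.Product using (Σ; ∃; _×_; _,_)
open import Data.List using (List; length)
open import Data.List.Membership.Propositional using (_∈_)
open import Data.List.Relation.Unary.Unique.Propositional using (Unique)
open import Function.Bundles using (_⇔_)
open import Relation.Nullary using (¬_)
open import Relation.Binary.PropositionalEquality using (_≡_)
open import Algebra.Structures using (IsCommutativeRing)

record Field : Set₁ where
  infixl 7 _*_
  infixl 6 _+_
  field
    Carrier : Set
    _+_ _*_ : Carrier → Carrier → Carrier
    -_ : Carrier → Carrier
    0# 1# : Carrier
    isCommutativeRing : IsCommutativeRing _≡_ _+_ _*_ -_ 0# 1#
    0≢1 : ¬ (0# ≡ 1#)
    inverse : (x : Carrier) → ¬ (x ≡ 0#) → ∃ λ y → x * y ≡ 1#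

HasCard : {A : Set} → (A → Set) → ℕ → Set
HasCard {A} P n = Σ (List A) λ xs → Unique xs × (∀ a → (a ∈ xs) ⇔ P a) × length xs ≡ n

module Geometry (F : Field) where
  open Field F

  _^_ : Carrier → ℕ → Carrier
  x ^ zero = 1#
  x ^ suc n = x * (x ^ n)

  -- Points of PG(2,K) via normalised homogeneous coordinates:
  -- (1,y,z), (0,1,z), (0,0,1).
  data Point : Set where
    pt₁ : Carrier → Carrier → Point
    pt₂ : Carrier → Point
    pt₃ : Point

  X Y Z : Point → Carrier
  X (pt₁ _ _) = 1#
  X (pt₂ _) = 0#
  X pt₃ = 0#
  Y (pt₁ y _) = y
  Y (pt₂ _) = 1#
  Y pt₃ = 0#
  Z (pt₁ _ z) = z
  Z (pt₂ z) = z
  Z pt₃ = 1#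

  record Line : Set where
    constructor [_,_,_]
    field a b c : Carrier

  _onLine_ : Point → Line → Set
  p onLine [ a , b , c ] = a * X p + b * Y p + c * Z p ≡ 0#

  perp : ℕ → Point → Line
  perp q p = [ Y p ^ q , X p ^ q , Z p ^ q ]

  U₂ : Point
  U₂ = pt₂ 0#

  onℓ : Point → Set
  onℓ p = X p ≡ 0#

  onU : ℕ → Carrier → Point → Set
  onU q λ' p = λ' * (X p ^ suc q) + (X p ^ q) * Y p + X p * (Y p ^ q) + (Z p ^ suc q) ≡ 0#

  inΣ : ℕ → (Carrier → Set) → Point → Set
  inΣ q H p = ¬ (p ≡ U₂) × ∃ λ h → H h × ∃ λ λ' → λ' * (h + 1#) ≡ 1# × onU q λ' p

module Submission where

-- Since |F| = q² is even, F has characteristic 2. Every point of Σ is affine, (1,y,z), and lies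
-- on U_λ exactly for λ = Tr y + N z, where Tr y = y + y^q and N z = z^(q+1) are the trace and
-- the norm onto F_q; so Σ is the set of affine points whose level Tr y + N z lies in Λ, a
-- subset of F_q of size q/2. The trace takes each value of F_q exactly q times and the norm
-- each nonzero value exactly q + 1 times: a polynomial bounds every fibre from above, and there
-- are too few fibres for any of them to be smaller. On the line x^⊥ of an affine point
-- x = (1,y₀,z₀), parametrised by z, the level is N(z + z₀) + c₀ with c₀ the level of x, so
-- x^⊥ ∩ Σ is counted by norm fibres over Λ + c₀; the one-point fibre over 0 occurs exactly
-- when x ∈ Σ. For x ∈ ℓ ∖ {U₂} the line x^⊥ is z = const and is counted by trace fibres, and
-- U₂^⊥ = ℓ has no affine point at all.

open import Defs
open import Data.Nat using (ℕ; zero; suc; _∸_; _/_; _≤_; _<_; z≤n; s≤s)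
  renaming (_*_ to _*ℕ_; _+_ to _+ℕ_; _^_ to _^ℕ_)
import Data.Nat.Properties as ℕ
open import Data.Nat.DivMod using (m*n/n≡m)
open import Data.Nat.ListAction using (sum)
open import Data.Nat.Solver using (module +-*-Solver)
open import Algebra.Bundles using (CommutativeRing)
open import Algebra.Properties.CommutativeSemigroup ℕ.+-commutativeSemigroup using (x∙yz≈y∙xz)
open import Data.Product using (∃; ∃₂; _×_; _,_; proj₁; proj₂; map₂)
open import Data.Sum using (inj₁; inj₂)
open import Data.Empty using (⊥-elim)
open import Data.Unit using (⊤; tt)
import Data.Fin as Fin
open import Data.List using (List; []; _∷_; length; map; filter; foldr; lookup)
import Data.List.Properties as List
open import Data.List.Membership.Propositional using (_∈_)
open import Data.List.Membership.Propositional.Properties using (∈-filter⁺; ∈-filter⁻; ∈-map⁺; ∈-map⁻)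
open import Data.List.Membership.Propositional.Properties.WithK using (unique∧set⇒bag)
open import Data.List.Relation.Unary.Any using (here; there; index)
open import Data.List.Relation.Unary.Any.Properties using (lookup-index)
open import Data.List.Relation.Unary.All as All using (All; []; _∷_)
import Data.List.Relation.Unary.All.Properties as All
open import Data.List.Relation.Unary.AllPairs using ([]; _∷_)
open import Data.List.Relation.Unary.Unique.Propositional using (Unique)
import Data.List.Relation.Unary.Unique.Propositional.Properties as Unique
open import Data.List.Relation.Binary.Permutation.Propositional using (_↭_; ↭⇒↭ₛ)
open import Data.List.Relation.Binary.Permutation.Propositional.Properties using (↭-length)
open import Data.List.Relation.Binary.Permutation.Setoid.Properties using (foldr-commMonoid)
open import Data.List.Relation.Binary.BagAndSetEquality using (∼bag⇒↭)
open import Function using (_∘_)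
open import Function.Bundles using (_⇔_; mk⇔; Equivalence)
import Function.Properties.Equivalence as ⇔
open import Level using (0ℓ)
open import Relation.Nullary using (¬_; yes; no; contradiction; ¬?)
open import Relation.Nullary.Decidable using (_×-dec_)
open import Relation.Unary using (Pred; Decidable)
open import Relation.Binary.Definitions using (DecidableEquality)
open import Relation.Binary.PropositionalEquality

sum≤length* : ∀ {B} xs → All (_≤ B) xs → sum xs ≤ length xs *ℕ B
sum≤length* []       []           = z≤n
sum≤length* (x ∷ xs) (x≤B ∷ xs≤B) = ℕ.+-mono-≤ x≤B (sum≤length* xs xs≤B)

sum≡length*⇒All≡ : ∀ {B} xs → All (_≤ B) xs → sum xs ≡ length xs *ℕ B → All (_≡ B) xs
sum≡length*⇒All≡ []       []           _  = []
sum≡length*⇒All≡ (x ∷ xs) (x≤B ∷ xs≤B) eq with ℕ.m≤n⇒m<n∨m≡n x≤B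
... | inj₁ x<B  = contradiction eq (ℕ.<⇒≢ (ℕ.+-mono-<-≤ x<B (sum≤length* xs xs≤B)))
... | inj₂ refl = refl ∷ sum≡length*⇒All≡ xs xs≤B (ℕ.+-cancelˡ-≡ x _ _ eq)

module _ {A : Set} where

  sum-map-const : ∀ {B} (f : A → ℕ) xs → (∀ x → x ∈ xs → f x ≡ B) → sum (map f xs) ≡ length xs *ℕ B
  sum-map-const f []       _   = refl
  sum-map-const f (x ∷ xs) f≡B = cong₂ _+ℕ_ (f≡B x (here refl)) (sum-map-const f xs (λ y → f≡B y ∘ there))

  -- The exceptional summand is traded for a copy of B, so that no subtraction occurs.
  sum-map-const-except : ∀ {B a} (f : A → ℕ) xs → Unique xs → a ∈ xs →
                         (∀ x → x ∈ xs → ¬ x ≡ a → f x ≡ B) →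
                         sum (map f xs) +ℕ B ≡ f a +ℕ length xs *ℕ B
  sum-map-const-except {B} f (x ∷ xs) (x∉xs ∷ _) (here refl) f≡B = begin
    f x +ℕ sum (map f xs) +ℕ B     ≡⟨ ℕ.+-assoc (f x) _ B ⟩
    f x +ℕ (sum (map f xs) +ℕ B)   ≡⟨ cong (f x +ℕ_) (ℕ.+-comm _ B) ⟩
    f x +ℕ (B +ℕ sum (map f xs))   ≡⟨ cong (λ s → f x +ℕ (B +ℕ s)) (sum-map-const f xs f≡B-on-xs) ⟩
    f x +ℕ (B +ℕ length xs *ℕ B)   ∎
    where
    open ≡-Reasoning
    f≡B-on-xs : ∀ y → y ∈ xs → f y ≡ B
    f≡B-on-xs y y∈xs = f≡B y (there y∈xs) (λ y≡x → All.lookup x∉xs y∈xs (sym y≡x))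
  sum-map-const-except {B} {a} f (x ∷ xs) (x∉xs ∷ xs!) (there a∈xs) f≡B = begin
    f x +ℕ sum (map f xs) +ℕ B     ≡⟨ ℕ.+-assoc (f x) _ B ⟩
    f x +ℕ (sum (map f xs) +ℕ B)   ≡⟨ cong₂ _+ℕ_ (f≡B x (here refl) x≢a)
                                                 (sum-map-const-except f xs xs! a∈xs (λ y → f≡B y ∘ there)) ⟩
    B +ℕ (f a +ℕ length xs *ℕ B)   ≡⟨ x∙yz≈y∙xz B (f a) _ ⟩
    f a +ℕ (B +ℕ length xs *ℕ B)   ∎
    where
    open ≡-Reasoning
    x≢a : ¬ x ≡ a
    x≢a = All.lookup x∉xs a∈xs

n*2/2≡n : ∀ n → n *ℕ 2 / 2 ≡ n
n*2/2≡n n = m*n/n≡m n 2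

module _ (k : ℕ) where
  open +-*-Solver

  2k/2≡k : (2 *ℕ k) / 2 ≡ k
  2k/2≡k = trans (cong (_/ 2) (ℕ.*-comm 2 k)) (n*2/2≡n k)

  [q²+q]/2≡k[q+1] : ((2 *ℕ k) *ℕ (2 *ℕ k) +ℕ 2 *ℕ k) / 2 ≡ k *ℕ suc (2 *ℕ k)
  [q²+q]/2≡k[q+1] = trans (cong (_/ 2) q²+q≡k[q+1]*2) (n*2/2≡n (k *ℕ suc (2 *ℕ k)))
    where
    q²+q≡k[q+1]*2 : (2 *ℕ k) *ℕ (2 *ℕ k) +ℕ 2 *ℕ k ≡ k *ℕ suc (2 *ℕ k) *ℕ 2
    q²+q≡k[q+1]*2 = solve 1 (λ k → (con 2 :* k) :* (con 2 :* k) :+ con 2 :* k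
                                   := k :* (con 1 :+ con 2 :* k) :* con 2) refl k

  q²/2≡kq : ((2 *ℕ k) *ℕ (2 *ℕ k)) / 2 ≡ k *ℕ (2 *ℕ k)
  q²/2≡kq = trans (cong (_/ 2) q²≡kq*2) (n*2/2≡n (k *ℕ (2 *ℕ k)))
    where
    q²≡kq*2 : (2 *ℕ k) *ℕ (2 *ℕ k) ≡ k *ℕ (2 *ℕ k) *ℕ 2
    q²≡kq*2 = solve 1 (λ k → (con 2 :* k) :* (con 2 :* k) := k :* (con 2 :* k) :* con 2) refl k

[q²-q]/2+q+1≡1+k[q+1] : ∀ k → ((2 *ℕ k) *ℕ (2 *ℕ k) ∸ 2 *ℕ k) / 2 +ℕ suc (2 *ℕ k) ≡ suc (k *ℕ suc (2 *ℕ k))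
[q²-q]/2+q+1≡1+k[q+1] zero    = refl
[q²-q]/2+q+1≡1+k[q+1] (suc j) = begin
  (q *ℕ q ∸ q) / 2 +ℕ suc q               ≡⟨ cong (λ n → (n ∸ q) / 2 +ℕ suc q) q²≡r*2+q ⟩
  (r *ℕ 2 +ℕ q ∸ q) / 2 +ℕ suc q          ≡⟨ cong (λ n → n / 2 +ℕ suc q) (ℕ.m+n∸n≡m (r *ℕ 2) q) ⟩
  (r *ℕ 2) / 2 +ℕ suc q                   ≡⟨ cong (_+ℕ suc q) (n*2/2≡n r) ⟩
  r +ℕ suc q                              ≡⟨ r+q+1≡1+k[q+1] ⟩
  suc (suc j *ℕ suc q)                    ∎
  where
  open ≡-Reasoning
  open +-*-Solver
  q r : ℕ
  q = 2 *ℕ suc j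
  r = suc j *ℕ suc (2 *ℕ j)
  q²≡r*2+q : q *ℕ q ≡ r *ℕ 2 +ℕ q
  q²≡r*2+q = solve 1 (λ j → (con 2 :* (con 1 :+ j)) :* (con 2 :* (con 1 :+ j))
                            := (con 1 :+ j) :* (con 1 :+ con 2 :* j) :* con 2 :+ con 2 :* (con 1 :+ j)) refl j
  r+q+1≡1+k[q+1] : r +ℕ suc q ≡ suc (suc j *ℕ suc q)
  r+q+1≡1+k[q+1] = solve 1 (λ j → (con 1 :+ j) :* (con 1 :+ con 2 :* j) :+ (con 1 :+ con 2 :* (con 1 :+ j))
                                  := con 1 :+ (con 1 :+ j) :* (con 1 :+ con 2 :* (con 1 :+ j))) refl j

[2+m]²≡1+[1+m][3+m] : ∀ m → suc (suc m) *ℕ suc (suc m) ≡ suc (suc m *ℕ suc (suc (suc m)))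
[2+m]²≡1+[1+m][3+m] = solve 1 (λ m → (con 2 :+ m) :* (con 2 :+ m) := con 1 :+ (con 1 :+ m) :* (con 3 :+ m)) refl
  where open +-*-Solver

↭-of-same-elements : ∀ {A : Set} {xs ys : List A} → Unique xs → Unique ys → (∀ a → a ∈ xs ⇔ a ∈ ys) → xs ↭ ys
↭-of-same-elements xs! ys! xs⇔ys = ∼bag⇒↭ (unique∧set⇒bag xs! ys! (λ {a} → xs⇔ys a))

module _ {A : Set} {P : A → Set} where

  HasCard-unique : ∀ {m n} → HasCard P m → HasCard P n → m ≡ n
  HasCard-unique (xs , xs! , xs⇔P , refl) (ys , ys! , ys⇔P , refl) =
    ↭-length (↭-of-same-elements xs! ys! (λ a → ⇔.trans (xs⇔P a) (⇔.sym (ys⇔P a))))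

  HasCard-⇔ : ∀ {Q : A → Set} {n} → (∀ a → P a ⇔ Q a) → HasCard P n → HasCard Q n
  HasCard-⇔ P⇔Q (xs , xs! , xs⇔P , len) = xs , xs! , (λ a → ⇔.trans (xs⇔P a) (P⇔Q a)) , len

  HasCard-∅ : (∀ a → ¬ P a) → HasCard P 0
  HasCard-∅ ¬P = [] , [] , (λ a → mk⇔ (λ ()) (⊥-elim ∘ ¬P a)) , refl

module FiniteEnumeration {A : Set} (U : List A) (U! : Unique U) (∈U : ∀ a → a ∈ U) where

  infix 4 _≟_
  _≟_ : DecidableEquality A
  x ≟ y with index (∈U x) Fin.≟ index (∈U y)
  ... | yes i≡j = yes (trans (lookup-index (∈U x)) (trans (cong (lookup U) i≡j) (sym (lookup-index (∈U y)))))
  ... | no  i≢j = no λ { refl → i≢j refl }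

  open import Data.List.Membership.DecPropositional _≟_ public using (_∈?_)

  count : {P : Pred A 0ℓ} → Decidable P → ℕ
  count P? = length (filter P? U)

  HasCard-count : {P : Pred A 0ℓ} (P? : Decidable P) → HasCard P (count P?)
  HasCard-count P? =
    filter P? U , Unique.filter⁺ P? U! , (λ a → mk⇔ (proj₂ ∘ ∈-filter⁻ P? {xs = U}) (∈-filter⁺ P? (∈U a))) , refl

  module _ {P : Pred A 0ℓ} (P? : Decidable P) where

    HasCard⇒count≡ : ∀ {n} → HasCard P n → count P? ≡ n
    HasCard⇒count≡ = HasCard-unique (HasCard-count P?)

    count-⊥ : (∀ a → ¬ P a) → count P? ≡ 0
    count-⊥ ¬P = HasCard⇒count≡ (HasCard-∅ ¬P)

    count-⊤ : (∀ a → P a) → count P? ≡ length U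
    count-⊤ P = HasCard⇒count≡ (U , U! , (λ a → mk⇔ (λ _ → P a) (λ _ → ∈U a)) , refl)

    module _ {Q : Pred A 0ℓ} (Q? : Decidable Q) where

      count-cong : (∀ a → P a ⇔ Q a) → count P? ≡ count Q?
      count-cong P⇔Q = HasCard⇒count≡ (HasCard-⇔ (λ a → ⇔.sym (P⇔Q a)) (HasCard-count Q?))

      count-split : count P? ≡ count (λ a → P? a ×-dec Q? a) +ℕ count (λ a → P? a ×-dec ¬? (Q? a))
      count-split = split U
        where
        split : ∀ xs → length (filter P? xs) ≡ length (filter (λ a → P? a ×-dec Q? a) xs)
                                               +ℕ length (filter (λ a → P? a ×-dec ¬? (Q? a)) xs)
        split []       = refl
        split (x ∷ xs) with P? x | Q? x
        ... | yes _ | yes _ = cong suc (split xs)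
        ... | yes _ | no  _ = trans (cong suc (split xs)) (sym (ℕ.+-suc _ _))
        ... | no  _ | yes _ = split xs
        ... | no  _ | no  _ = split xs

  count-mono : {P Q : Pred A 0ℓ} (P? : Decidable P) (Q? : Decidable Q) → (∀ a → P a → Q a) → count P? ≤ count Q?
  count-mono {P} {Q} P? Q? P⇒Q = begin
    count P?                                           ≡⟨ count-cong P? Q∧P? (λ a → mk⇔ (λ p → P⇒Q a p , p) proj₂) ⟩
    count Q∧P?                                         ≤⟨ ℕ.m≤m+n _ _ ⟩
    count Q∧P? +ℕ count (λ a → Q? a ×-dec ¬? (P? a))   ≡⟨ count-split Q? P? ⟨
    count Q?                                           ∎
    where
    open ℕ.≤-Reasoning
    Q∧P? : Decidable (λ a → Q a × P a)
    Q∧P? a = Q? a ×-dec P? a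

  count-≟ : ∀ a → count (_≟ a) ≡ 1
  count-≟ a = HasCard⇒count≡ (_≟ a) (a ∷ [] , [] ∷ [] , (λ x → mk⇔ ∈[a]⇒≡a here) , refl)
    where
    ∈[a]⇒≡a : ∀ {x} → x ∈ a ∷ [] → x ≡ a
    ∈[a]⇒≡a (here x≡a) = x≡a

  HasCard-image : {B : Set} {P : B → Set} {C : Pred A 0ℓ} (C? : Decidable C) (φ : A → B) →
                  (∀ {a b} → φ a ≡ φ b → a ≡ b) →
                  (∀ b → P b → ∃ λ c → C c × b ≡ φ c) → (∀ c → C c → P (φ c)) → HasCard P (count C?)
  HasCard-image {P = P} C? φ φ-injective P⇒image C⇒P =
    map φ (filter C? U) , Unique.map⁺ φ-injective (Unique.filter⁺ C? U!) , (λ b → mk⇔ (to b) (from b)) ,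
    List.length-map φ (filter C? U)
    where
    to : ∀ b → b ∈ map φ (filter C? U) → P b
    to b b∈ with c , c∈ , refl ← ∈-map⁻ φ b∈ = C⇒P c (proj₂ (∈-filter⁻ C? {xs = U} c∈))
    from : ∀ b → P b → b ∈ map φ (filter C? U)
    from b Pb with c , Cc , refl ← P⇒image b Pb = ∈-map⁺ φ (∈-filter⁺ C? (∈U c) Cc)

  count-∘-bijection : {P : Pred A 0ℓ} (P? : Decidable P) (f g : A → A) →
                      (∀ x → g (f x) ≡ x) → (∀ y → f (g y) ≡ y) → count (P? ∘ f) ≡ count P?
  count-∘-bijection {P} P? f g gf≡id fg≡id =
    sym (HasCard⇒count≡ P? (HasCard-image (P? ∘ f) f f-injective image (λ _ Pfx → Pfx)))
    where
    f-injective : ∀ {x y} → f x ≡ f y → x ≡ y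
    f-injective {x} {y} fx≡fy = trans (sym (gf≡id x)) (trans (cong g fx≡fy) (gf≡id y))
    image : ∀ y → P y → ∃ λ x → P (f x) × y ≡ f x
    image y Py = g y , subst P (sym (fg≡id y)) Py , sym (fg≡id y)

  fibreSize : (A → A) → A → ℕ
  fibreSize f t = count (λ w → f w ≟ t)

  count-preimage : (f : A → A) {ts : List A} → Unique ts → count (λ w → f w ∈? ts) ≡ sum (map (fibreSize f) ts)
  count-preimage f {[]}     []           = count-⊥ _ (λ _ ())
  count-preimage f {t ∷ ts} (t∉ts ∷ ts!) = begin
    count (λ w → f w ∈? t ∷ ts)
      ≡⟨ count-split _ (λ w → f w ≟ t) ⟩
    count (λ w → f w ∈? t ∷ ts ×-dec f w ≟ t) +ℕ count (λ w → f w ∈? t ∷ ts ×-dec ¬? (f w ≟ t))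
      ≡⟨ cong₂ _+ℕ_ (count-cong _ _ (λ _ → mk⇔ proj₂ (λ e → here e , e))) (count-cong _ _ (λ _ → mk⇔ in-ts in-t∷ts)) ⟩
    fibreSize f t +ℕ count (λ w → f w ∈? ts)
      ≡⟨ cong (fibreSize f t +ℕ_) (count-preimage f ts!) ⟩
    fibreSize f t +ℕ sum (map (fibreSize f) ts)
      ∎
    where
    open ≡-Reasoning
    in-ts : ∀ {s} → s ∈ t ∷ ts × ¬ s ≡ t → s ∈ ts
    in-ts (here s≡t , s≢t) = ⊥-elim (s≢t s≡t)
    in-ts (there s∈ , _)   = s∈
    in-t∷ts : ∀ {s} → s ∈ ts → s ∈ t ∷ ts × ¬ s ≡ t
    in-t∷ts s∈ = there s∈ , λ s≡t → All.lookup t∉ts s∈ (sym s≡t)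

  fibreSize-forced : (f : A → A) {ts : List A} {B L : ℕ} → Unique ts → length ts ≤ L →
                     (∀ t → t ∈ ts → fibreSize f t ≤ B) → L *ℕ B ≤ count (λ w → f w ∈? ts) →
                     ∀ t → t ∈ ts → fibreSize f t ≡ B
  fibreSize-forced f {ts} {B} {L} ts! |ts|≤L fibre≤B total t t∈ts =
    All.lookup (sum≡length*⇒All≡ sizes sizes≤B sum≡) (∈-map⁺ (fibreSize f) t∈ts)
    where
    sizes : List ℕ
    sizes = map (fibreSize f) ts
    sizes≤B : All (_≤ B) sizes
    sizes≤B = All.map⁺ (All.tabulate (λ {t} → fibre≤B t))
    sum≡ : sum sizes ≡ length sizes *ℕ B
    sum≡ = ℕ.≤-antisym (sum≤length* sizes sizes≤B) (begin
      length sizes *ℕ B         ≡⟨ cong (_*ℕ B) (List.length-map (fibreSize f) ts) ⟩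
      length ts *ℕ B            ≤⟨ ℕ.*-monoˡ-≤ B |ts|≤L ⟩
      L *ℕ B                    ≤⟨ total ⟩
      count (λ w → f w ∈? ts)   ≡⟨ count-preimage f ts! ⟩
      sum sizes                 ∎)
      where open ℕ.≤-Reasoning

module FieldProperties (F : Field) where

  open Field F
  open Geometry F using (_^_)

  commutativeRing : CommutativeRing 0ℓ 0ℓ
  commutativeRing = record { isCommutativeRing = isCommutativeRing }

  open CommutativeRing commutativeRing public
    using (+-assoc; +-comm; +-identityˡ; +-identityʳ; -‿inverseˡ; -‿inverseʳ;
           *-assoc; *-comm; *-identityˡ; *-identityʳ; distribˡ; zeroˡ; zeroʳ;
           commutativeSemiring; +-isCommutativeMonoid; *-isCommutativeMonoid)
  open import Algebra.Properties.Group (CommutativeRing.+-group commutativeRing) public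
    using () renaming (∙-cancelˡ to +-cancelˡ; ∙-cancelʳ to +-cancelʳ; x∙y⁻¹≈ε⇒x≈y to x-y≡0⇒x≡y)
  open import Algebra.Properties.Semiring.Mult (CommutativeRing.semiring commutativeRing) public
    using () renaming (_×_ to _·_; ×1-homo-* to ·1-homo-*)
  open import Algebra.Solver.Ring.NaturalCoefficients.Default commutativeSemiring public
    using (solve; _:+_; _:*_; _:=_; con)

  infixl 6 _-_
  _-_ : Carrier → Carrier → Carrier
  x - y = x + - y

  -≡0⇒≡0 : ∀ {c} → - c ≡ 0# → c ≡ 0#
  -≡0⇒≡0 {c} -c≡0 = trans (sym (+-identityʳ c)) (trans (cong (c +_) (sym -c≡0)) (-‿inverseʳ c))

  1≢0 : ¬ 1# ≡ 0#
  1≢0 1≡0 = 0≢1 (sym 1≡0)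

  *-cancelˡ : ∀ a b c → ¬ a ≡ 0# → a * b ≡ a * c → b ≡ c
  *-cancelˡ a b c a≢0 ab≡ac with a′ , aa′≡1 ← inverse a a≢0 = begin
    b               ≡⟨ *-identityˡ b ⟨
    1# * b          ≡⟨ cong (_* b) (trans (sym aa′≡1) (*-comm a a′)) ⟩
    (a′ * a) * b    ≡⟨ *-assoc a′ a b ⟩
    a′ * (a * b)    ≡⟨ cong (a′ *_) ab≡ac ⟩
    a′ * (a * c)    ≡⟨ *-assoc a′ a c ⟨
    (a′ * a) * c    ≡⟨ cong (_* c) (trans (*-comm a′ a) aa′≡1) ⟩
    1# * c          ≡⟨ *-identityˡ c ⟩
    c               ∎
    where open ≡-Reasoning

  *-cancelʳ : ∀ a b c → ¬ a ≡ 0# → b * a ≡ c * a → b ≡ c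
  *-cancelʳ a b c a≢0 ba≡ca = *-cancelˡ a b c a≢0 (trans (*-comm a b) (trans ba≡ca (*-comm c a)))

  *-≢0 : ∀ {a b} → ¬ a ≡ 0# → ¬ b ≡ 0# → ¬ a * b ≡ 0#
  *-≢0 {a} {b} a≢0 b≢0 ab≡0 = b≢0 (*-cancelˡ a b 0# a≢0 (trans ab≡0 (sym (zeroʳ a))))

  ^-≢0 : ∀ {x} n → ¬ x ≡ 0# → ¬ x ^ n ≡ 0#
  ^-≢0 zero    _   = 1≢0
  ^-≢0 (suc n) x≢0 = *-≢0 x≢0 (^-≢0 n x≢0)

  1^ : ∀ n → 1# ^ n ≡ 1#
  1^ zero    = refl
  1^ (suc n) = trans (*-identityˡ _) (1^ n)

  ^-+ : ∀ x m n → x ^ (m +ℕ n) ≡ x ^ m * x ^ n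
  ^-+ x zero    n = sym (*-identityˡ _)
  ^-+ x (suc m) n = trans (cong (x *_) (^-+ x m n)) (sym (*-assoc _ _ _))

  ^-distrib-* : ∀ x y n → (x * y) ^ n ≡ x ^ n * y ^ n
  ^-distrib-* x y zero    = sym (*-identityˡ 1#)
  ^-distrib-* x y (suc n) = trans (cong ((x * y) *_) (^-distrib-* x y n))
    (solve 4 (λ x y a b → (x :* y) :* (a :* b) := (x :* a) :* (y :* b)) refl x y (x ^ n) (y ^ n))

  ^-* : ∀ x m n → x ^ (m *ℕ n) ≡ (x ^ m) ^ n
  ^-* x zero    n = sym (1^ n)
  ^-* x (suc m) n = begin
    x ^ (n +ℕ m *ℕ n)      ≡⟨ ^-+ x n (m *ℕ n) ⟩
    x ^ n * x ^ (m *ℕ n)   ≡⟨ cong (x ^ n *_) (^-* x m n) ⟩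
    x ^ n * (x ^ m) ^ n    ≡⟨ ^-distrib-* x (x ^ m) n ⟨
    (x * x ^ m) ^ n        ∎
    where open ≡-Reasoning

  ∑ ∏ : List Carrier → Carrier
  ∑ = foldr _+_ 0#
  ∏ = foldr _*_ 1#

  ∑-↭ : ∀ {xs ys} → xs ↭ ys → ∑ xs ≡ ∑ ys
  ∑-↭ xs↭ys = foldr-commMonoid (setoid Carrier) +-isCommutativeMonoid (↭⇒↭ₛ xs↭ys)

  ∏-↭ : ∀ {xs ys} → xs ↭ ys → ∏ xs ≡ ∏ ys
  ∏-↭ xs↭ys = foldr-commMonoid (setoid Carrier) *-isCommutativeMonoid (↭⇒↭ₛ xs↭ys)

  ∑-map-1+ : ∀ xs → ∑ (map (1# +_) xs) ≡ length xs · 1# + ∑ xs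
  ∑-map-1+ []       = sym (+-identityˡ _)
  ∑-map-1+ (x ∷ xs) = trans (cong ((1# + x) +_) (∑-map-1+ xs))
    (solve 3 (λ x n s → (con 1 :+ x) :+ (n :+ s) := (con 1 :+ n) :+ (x :+ s)) refl x (length xs · 1#) (∑ xs))

  ∏-map-* : ∀ a xs → ∏ (map (a *_) xs) ≡ a ^ length xs * ∏ xs
  ∏-map-* a []       = sym (*-identityˡ 1#)
  ∏-map-* a (x ∷ xs) = trans (cong ((a * x) *_) (∏-map-* a xs))
    (solve 4 (λ a x p r → (a :* x) :* (p :* r) := (a :* p) :* (x :* r)) refl a x (a ^ length xs) (∏ xs))

  ∏-≢0 : ∀ xs → All (λ x → ¬ x ≡ 0#) xs → ¬ ∏ xs ≡ 0#
  ∏-≢0 []       []           = 1≢0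
  ∏-≢0 (x ∷ xs) (x≢0 ∷ xs≢0) = *-≢0 x≢0 (∏-≢0 xs xs≢0)

  eval : List Carrier → Carrier → Carrier
  eval []       x = 0#
  eval (a ∷ as) x = a + x * eval as x

  divide : List Carrier → Carrier → List Carrier
  divide []           r = []
  divide (a ∷ [])     r = []
  divide (a ∷ b ∷ bs) r = eval (b ∷ bs) r ∷ divide (b ∷ bs) r

  length-divide : ∀ a as r → length (divide (a ∷ as) r) ≡ length as
  length-divide a []       r = refl
  length-divide a (b ∷ bs) r = cong suc (length-divide b bs r)

  eval-divide : ∀ p r x → eval p x ≡ eval p r + (x - r) * eval (divide p r) x
  eval-divide []           r x = sym (trans (+-identityˡ _) (zeroʳ _))
  eval-divide (a ∷ [])     r x = begin
    a + x * 0#                  ≡⟨ cong (a +_) (trans (zeroʳ x) (sym (zeroʳ r))) ⟩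
    a + r * 0#                  ≡⟨ +-identityʳ _ ⟨
    a + r * 0# + 0#             ≡⟨ cong (a + r * 0# +_) (zeroʳ (x - r)) ⟨
    a + r * 0# + (x - r) * 0#   ∎
    where open ≡-Reasoning
  eval-divide (a ∷ b ∷ bs) r x = begin
    a + x * eval (b ∷ bs) x                   ≡⟨ cong (λ v → a + x * v) (eval-divide (b ∷ bs) r x) ⟩
    a + x * (S + (x - r) * D)                 ≡⟨ +-identityʳ _ ⟨
    a + x * (S + (x - r) * D) + 0#            ≡⟨ cong (a + x * (S + (x - r) * D) +_) [r-r]S≡0 ⟨
    a + x * (S + (x - r) * D) + (r - r) * S   ≡⟨ solve 6 (λ a x r r′ S D → a :+ x :* (S :+ (x :+ r′) :* D) :+ (r :+ r′) :* S
                                                                := a :+ r :* S :+ (x :+ r′) :* (S :+ x :* D)) refl a x r (- r) S D ⟩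
    a + r * S + (x - r) * (S + x * D)         ∎
    where
    open ≡-Reasoning
    S D : Carrier
    S = eval (b ∷ bs) r
    D = eval (divide (b ∷ bs) r) x
    [r-r]S≡0 : (r - r) * S ≡ 0#
    [r-r]S≡0 = trans (cong (_* S) (-‿inverseʳ r)) (zeroˡ S)

  eval≡0-of-roots : ∀ p {rs} → Unique rs → All (λ r → eval p r ≡ 0#) rs → length p ≤ length rs → ∀ x → eval p x ≡ 0#
  eval≡0-of-roots []       _                 _              _           x = refl
  eval≡0-of-roots (a ∷ as) {r ∷ rs} (r∉rs ∷ rs!) (pr≡0 ∷ prs≡0) (s≤s |as|≤) x = begin
    eval p x                                   ≡⟨ eval-divide p r x ⟩
    eval p r + (x - r) * eval (divide p r) x   ≡⟨ cong₂ (λ u v → u + (x - r) * v) pr≡0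
                                                        (eval≡0-of-roots (divide p r) rs! quotient-roots |quotient|≤ x) ⟩
    0# + (x - r) * 0#                          ≡⟨ trans (+-identityˡ _) (zeroʳ _) ⟩
    0#                                         ∎
    where
    open ≡-Reasoning
    p : List Carrier
    p = a ∷ as
    |quotient|≤ : length (divide p r) ≤ length rs
    |quotient|≤ = subst (_≤ length rs) (sym (length-divide a as r)) |as|≤
    quotient-root : ∀ {s} → ¬ r ≡ s → eval p s ≡ 0# → eval (divide p r) s ≡ 0#
    quotient-root {s} r≢s ps≡0 = *-cancelˡ (s - r) _ _ (λ s-r≡0 → r≢s (sym (x-y≡0⇒x≡y s r s-r≡0))) (begin
      (s - r) * eval (divide p r) s              ≡⟨ +-identityˡ _ ⟨
      0# + (s - r) * eval (divide p r) s         ≡⟨ cong (_+ (s - r) * eval (divide p r) s) pr≡0 ⟨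
      eval p r + (s - r) * eval (divide p r) s   ≡⟨ eval-divide p r s ⟨
      eval p s                                   ≡⟨ ps≡0 ⟩
      0#                                         ≡⟨ zeroʳ (s - r) ⟨
      (s - r) * 0#                               ∎)
    quotient-roots : All (λ s → eval (divide p r) s ≡ 0#) rs
    quotient-roots = All.zipWith (λ (r≢s , ps≡0) → quotient-root r≢s ps≡0) (r∉rs , prs≡0)

  monomial : ℕ → List Carrier
  monomial zero    = 1# ∷ []
  monomial (suc n) = 0# ∷ monomial n

  eval-monomial : ∀ n x → eval (monomial n) x ≡ x ^ n
  eval-monomial zero    x = trans (cong (1# +_) (zeroʳ x)) (+-identityʳ 1#)
  eval-monomial (suc n) x = trans (+-identityˡ _) (cong (x *_) (eval-monomial n x))

  length-monomial : ∀ n → length (monomial n) ≡ suc n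
  length-monomial zero    = refl
  length-monomial (suc n) = cong suc (length-monomial n)

module FiniteField (F : Field) (U : List (Field.Carrier F)) (U! : Unique U) (∈U : ∀ a → a ∈ U) where

  open Field F
  open Geometry F using (_^_)
  open FieldProperties F public
  open FiniteEnumeration U U! ∈U public

  ^≡0⇒≡0 : ∀ {x} n → x ^ n ≡ 0# → x ≡ 0#
  ^≡0⇒≡0 {x} n xⁿ≡0 with x ≟ 0#
  ... | yes x≡0 = x≡0
  ... | no  x≢0 = ⊥-elim (^-≢0 n x≢0 xⁿ≡0)

  -- The inverse made total by 0 ⁻¹ = 0.
  infix 8 _⁻¹
  _⁻¹ : Carrier → Carrier
  x ⁻¹ with x ≟ 0#
  ... | yes _   = 0#
  ... | no  x≢0 = proj₁ (inverse x x≢0)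

  ⁻¹-inverseʳ : ∀ {x} → ¬ x ≡ 0# → x * x ⁻¹ ≡ 1#
  ⁻¹-inverseʳ {x} x≢0 with x ≟ 0#
  ... | yes x≡0 = ⊥-elim (x≢0 x≡0)
  ... | no  x≢0 = proj₂ (inverse x x≢0)

  ⁻¹-unique : ∀ {x y} → x * y ≡ 1# → y ≡ x ⁻¹
  ⁻¹-unique {x} {y} xy≡1 = *-cancelˡ x y (x ⁻¹) x≢0 (trans xy≡1 (sym (⁻¹-inverseʳ x≢0)))
    where
    x≢0 : ¬ x ≡ 0#
    x≢0 x≡0 = 1≢0 (trans (sym xy≡1) (trans (cong (_* y) x≡0) (zeroˡ y)))

  ⁻¹-≢0 : ∀ {x} → ¬ x ≡ 0# → ¬ x ⁻¹ ≡ 0#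
  ⁻¹-≢0 {x} x≢0 x⁻¹≡0 = 1≢0 (trans (sym (⁻¹-inverseʳ x≢0)) (trans (cong (x *_) x⁻¹≡0) (zeroʳ x)))

  ⁻¹-involutive : ∀ x → x ⁻¹ ⁻¹ ≡ x
  ⁻¹-involutive x with x ≟ 0#
  ... | no  x≢0 with x′ , xx′≡1 ← inverse x x≢0 = sym (⁻¹-unique (trans (*-comm x′ x) xx′≡1))
  ... | yes refl with 0# ≟ 0#
  ...   | yes _   = refl
  ...   | no  0≢0 = ⊥-elim (0≢0 refl)

  -- Translation by 1 permutes F, so it leaves the sum of all elements unchanged.
  order·1≡0 : length U · 1# ≡ 0#
  order·1≡0 = +-cancelʳ (∑ U) _ _ (begin
    length U · 1# + ∑ U   ≡⟨ ∑-map-1+ U ⟨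
    ∑ (map (1# +_) U)     ≡⟨ ∑-↭ (↭-of-same-elements (Unique.map⁺ (+-cancelˡ 1# _ _) U!) U!
                                                      (λ a → mk⇔ (λ _ → ∈U a) (λ _ → 1+-image a))) ⟩
    ∑ U                   ≡⟨ +-identityˡ (∑ U) ⟨
    0# + ∑ U              ∎)
    where
    open ≡-Reasoning
    1+-image : ∀ a → a ∈ map (1# +_) U
    1+-image a = subst (_∈ map (1# +_) U) (trans (sym (+-assoc _ _ _)) (trans (cong (_+ a) (-‿inverseʳ 1#)) (+-identityˡ a)))
                       (∈-map⁺ (1# +_) (∈U (- 1# + a)))

  order-2^k⇒1+1≡0 : ∀ k → length U ≡ 2 ^ℕ k → 1# + 1# ≡ 0#
  order-2^k⇒1+1≡0 k |F|≡2^k =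
    trans (cong (1# +_) (sym (+-identityʳ 1#))) (2^k·1≡0⇒2·1≡0 k (subst (λ n → n · 1# ≡ 0#) |F|≡2^k order·1≡0))
    where
    2^k·1≡0⇒2·1≡0 : ∀ k → (2 ^ℕ k) · 1# ≡ 0# → 2 · 1# ≡ 0#
    2^k·1≡0⇒2·1≡0 zero    1+0≡0 = ⊥-elim (1≢0 (trans (sym (+-identityʳ 1#)) 1+0≡0))
    2^k·1≡0⇒2·1≡0 (suc k) 2^[1+k]·1≡0 with 2 · 1# ≟ 0#
    ... | yes 2·1≡0 = 2·1≡0
    ... | no  2·1≢0 = 2^k·1≡0⇒2·1≡0 k (*-cancelˡ (2 · 1#) _ 0# 2·1≢0
                        (trans (sym (·1-homo-* 2 (2 ^ℕ k))) (trans 2^[1+k]·1≡0 (sym (zeroʳ _)))))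

  count-complement : {P : Pred Carrier 0ℓ} (P? : Decidable P) → length U ≡ count P? +ℕ count (¬? ∘ P?)
  count-complement P? = begin
    length U
      ≡⟨ cong length (List.filter-all ⊤? {xs = U} (All.tabulate (λ _ → tt))) ⟨
    count ⊤?
      ≡⟨ count-split ⊤? P? ⟩
    count (λ a → ⊤? a ×-dec P? a) +ℕ count (λ a → ⊤? a ×-dec ¬? (P? a))
      ≡⟨ cong₂ _+ℕ_ (count-cong _ P? (λ _ → mk⇔ proj₂ (tt ,_))) (count-cong _ (¬? ∘ P?) (λ _ → mk⇔ proj₂ (tt ,_))) ⟩
    count P? +ℕ count (¬? ∘ P?)
      ∎
    where
    open ≡-Reasoning
    ⊤? : Decidable {A = Carrier} (λ _ → ⊤)
    ⊤? _ = yes tt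

  nonzero? : Decidable (λ x → ¬ x ≡ 0#)
  nonzero? = ¬? ∘ (_≟ 0#)

  order≡1+count-nonzero : length U ≡ suc (count nonzero?)
  order≡1+count-nonzero = trans (count-complement (_≟ 0#)) (cong (_+ℕ count nonzero?) (count-≟ 0#))

  -- Scaling by a ≢ 0 permutes the nonzero elements, so it leaves their product unchanged.
  ^-count-nonzero≡1 : ∀ {a} → ¬ a ≡ 0# → a ^ count nonzero? ≡ 1#
  ^-count-nonzero≡1 {a} a≢0 = *-cancelʳ (∏ F*) _ _ (∏-≢0 F* (All.tabulate F*-nonzero)) (begin
    a ^ length F* * ∏ F*   ≡⟨ ∏-map-* a F* ⟨
    ∏ (map (a *_) F*)      ≡⟨ ∏-↭ (↭-of-same-elements (Unique.map⁺ (*-cancelˡ a _ _ a≢0) F*!) F*!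
                                                       (λ c → mk⇔ (scaled c) (scaled-image c))) ⟩
    ∏ F*                   ≡⟨ *-identityˡ _ ⟨
    1# * ∏ F*              ∎)
    where
    open ≡-Reasoning
    F* : List Carrier
    F* = filter nonzero? U
    F*! : Unique F*
    F*! = Unique.filter⁺ nonzero? U!
    F*-nonzero : ∀ {b} → b ∈ F* → ¬ b ≡ 0#
    F*-nonzero b∈ = proj₂ (∈-filter⁻ nonzero? {xs = U} b∈)
    scaled : ∀ c → c ∈ map (a *_) F* → c ∈ F*
    scaled c c∈ with b , b∈ , refl ← ∈-map⁻ (a *_) c∈ = ∈-filter⁺ nonzero? (∈U (a * b)) (*-≢0 a≢0 (F*-nonzero b∈))
    scaled-image : ∀ b → b ∈ F* → b ∈ map (a *_) F*
    scaled-image b b∈ = subst (_∈ map (a *_) F*) a[a⁻¹b]≡b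
      (∈-map⁺ (a *_) (∈-filter⁺ nonzero? (∈U (a ⁻¹ * b)) (*-≢0 (⁻¹-≢0 a≢0) (F*-nonzero b∈))))
      where
      a[a⁻¹b]≡b : a * (a ⁻¹ * b) ≡ b
      a[a⁻¹b]≡b = trans (sym (*-assoc _ _ _)) (trans (cong (_* b) (⁻¹-inverseʳ a≢0)) (*-identityˡ b))

  fermat : ∀ a → a ^ length U ≡ a
  fermat a rewrite order≡1+count-nonzero with a ≟ 0#
  ... | yes refl = zeroˡ _
  ... | no  a≢0  = trans (cong (a *_) (^-count-nonzero≡1 a≢0)) (*-identityʳ a)

  count-roots<length : ∀ p {P : Pred Carrier 0ℓ} (P? : Decidable P) → (∀ x → P x → eval p x ≡ 0#) →
                       ¬ eval p 0# ≡ 0# → count P? < length p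
  count-roots<length p P? P⇒root p[0]≢0 with length p ℕ.≤? count P?
  ... | no  |p|≰ = ℕ.≰⇒> |p|≰
  ... | yes |p|≤ = ⊥-elim (p[0]≢0 (eval≡0-of-roots p (Unique.filter⁺ P? U!) roots |p|≤ 0#))
    where
    roots : All (λ x → eval p x ≡ 0#) (filter P? U)
    roots = All.tabulate (λ {x} x∈ → P⇒root x (proj₂ (∈-filter⁻ P? {xs = U} x∈)))

  count[x^1+n≡c]≤1+n : ∀ n {c} → ¬ c ≡ 0# → count (λ x → x ^ suc n ≟ c) ≤ suc n
  count[x^1+n≡c]≤1+n n {c} c≢0 =
    ℕ.≤-pred (subst (count (λ x → x ^ suc n ≟ c) <_) (cong suc (length-monomial n))
      (count-roots<length (- c ∷ monomial n) (λ x → x ^ suc n ≟ c) root (c≢0 ∘ -≡0⇒≡0 ∘ trans (sym p[0]≡-c))))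
    where
    p[0]≡-c : eval (- c ∷ monomial n) 0# ≡ - c
    p[0]≡-c = trans (cong (- c +_) (zeroˡ _)) (+-identityʳ _)
    root : ∀ x → x ^ suc n ≡ c → eval (- c ∷ monomial n) x ≡ 0#
    root x x^1+n≡c = trans (cong (λ v → - c + x * v) (eval-monomial n x)) (trans (cong (- c +_) x^1+n≡c) (-‿inverseˡ c))

  count[y+y^2+n≡t]≤2+n : ∀ n {t} → ¬ t ≡ 0# → count (λ y → y + y ^ suc (suc n) ≟ t) ≤ suc (suc n)
  count[y+y^2+n≡t]≤2+n n {t} t≢0 =
    ℕ.≤-pred (subst (count (λ y → y + y ^ suc (suc n) ≟ t) <_) (cong (suc ∘ suc) (length-monomial n))
      (count-roots<length (- t ∷ 1# ∷ monomial n) (λ y → y + y ^ suc (suc n) ≟ t) root (t≢0 ∘ -≡0⇒≡0 ∘ trans (sym p[0]≡-t))))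
    where
    p[0]≡-t : eval (- t ∷ 1# ∷ monomial n) 0# ≡ - t
    p[0]≡-t = trans (cong (- t +_) (zeroˡ _)) (+-identityʳ _)
    root : ∀ y → y + y ^ suc (suc n) ≡ t → eval (- t ∷ 1# ∷ monomial n) y ≡ 0#
    root y y+y^2+n≡t = begin
      - t + y * (1# + y * eval (monomial n) y)   ≡⟨ cong (λ v → - t + y * (1# + y * v)) (eval-monomial n y) ⟩
      - t + y * (1# + y ^ suc n)                 ≡⟨ cong (- t +_) (trans (distribˡ y 1# _) (cong (_+ y ^ suc (suc n)) (*-identityʳ y)))
                                                  ⟩
      - t + (y + y ^ suc (suc n))                ≡⟨ cong (- t +_) y+y^2+n≡t ⟩
      - t + t                                    ≡⟨ -‿inverseˡ t ⟩
      0#                                         ∎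
      where open ≡-Reasoning

module Characteristic2 (F : Field) (1+1≡0 : Field._+_ F (Field.1# F) (Field.1# F) ≡ Field.0# F) where

  open Field F
  open Geometry F using (_^_)
  open FieldProperties F

  x+x≡0 : ∀ x → x + x ≡ 0#
  x+x≡0 x = begin
    x + x               ≡⟨ cong₂ _+_ (*-identityʳ x) (*-identityʳ x) ⟨
    x * 1# + x * 1#     ≡⟨ distribˡ x 1# 1# ⟨
    x * (1# + 1#)       ≡⟨ cong (x *_) 1+1≡0 ⟩
    x * 0#              ≡⟨ zeroʳ x ⟩
    0#                  ∎
    where open ≡-Reasoning

  x+y≡0⇒x≡y : ∀ {x y} → x + y ≡ 0# → x ≡ y
  x+y≡0⇒x≡y {x} {y} x+y≡0 = +-cancelʳ y x y (trans x+y≡0 (sym (x+x≡0 y)))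

  x+y+y≡x : ∀ x y → x + y + y ≡ x
  x+y+y≡x x y = trans (+-assoc x y y) (trans (cong (x +_) (x+x≡0 y)) (+-identityʳ x))

  x+y≡z⇒x≡z+y : ∀ {x y z} → x + y ≡ z → x ≡ z + y
  x+y≡z⇒x≡z+y {x} {y} x+y≡z = trans (sym (x+y+y≡x x y)) (cong (_+ y) x+y≡z)

  +-square : ∀ x y → (x + y) * (x + y) ≡ x * x + y * y
  +-square x y = begin
    (x + y) * (x + y)                  ≡⟨ solve 2 (λ x y → (x :+ y) :* (x :+ y) := (x :* x :+ y :* y) :+ (x :* y :+ x :* y))
                                                  refl x y ⟩
    (x * x + y * y) + (x * y + x * y)  ≡⟨ cong ((x * x + y * y) +_) (x+x≡0 (x * y)) ⟩
    (x * x + y * y) + 0#               ≡⟨ +-identityʳ _ ⟩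
    x * x + y * y                      ∎
    where open ≡-Reasoning

  frobenius-+ : ∀ k x y → (x + y) ^ (2 ^ℕ k) ≡ x ^ (2 ^ℕ k) + y ^ (2 ^ℕ k)
  frobenius-+ zero    x y = trans (*-identityʳ _) (sym (cong₂ _+_ (*-identityʳ x) (*-identityʳ y)))
  frobenius-+ (suc k) x y = begin
    (x + y) ^ (2 *ℕ n)                       ≡⟨ ^-double (x + y) ⟩
    (x + y) ^ n * (x + y) ^ n                ≡⟨ cong₂ _*_ (frobenius-+ k x y) (frobenius-+ k x y) ⟩
    (x ^ n + y ^ n) * (x ^ n + y ^ n)        ≡⟨ +-square _ _ ⟩
    x ^ n * x ^ n + y ^ n * y ^ n            ≡⟨ cong₂ _+_ (^-double x) (^-double y) ⟨
    x ^ (2 *ℕ n) + y ^ (2 *ℕ n)              ∎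
    where
    open ≡-Reasoning
    n : ℕ
    n = 2 ^ℕ k
    ^-double : ∀ x → x ^ (2 *ℕ n) ≡ x ^ n * x ^ n
    ^-double x = trans (^-+ x n (n +ℕ 0)) (cong (λ i → x ^ n * x ^ i) (ℕ.+-identityʳ n))

module FieldOfOrderSquare (F : Field) (U : List (Field.Carrier F)) (U! : Unique U) (∈U : ∀ a → a ∈ U)
                          (e : ℕ) (|F|≡q² : length U ≡ 2 ^ℕ suc e *ℕ 2 ^ℕ suc e) where

  open Field F
  open Geometry F using (_^_)
  open FiniteField F U U! ∈U public

  q : ℕ
  q = 2 ^ℕ suc e

  q-2 : ℕ
  q-2 = q ∸ 2

  q≡2+[q-2] : q ≡ suc (suc q-2)
  q≡2+[q-2] = sym (ℕ.m+[n∸m]≡n (ℕ.*-monoʳ-≤ 2 (ℕ.m^n>0 2 e)))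

  1+1≡0 : 1# + 1# ≡ 0#
  1+1≡0 = order-2^k⇒1+1≡0 (suc e +ℕ suc e) (trans |F|≡q² (sym (ℕ.^-distribˡ-+-* 2 (suc e) (suc e))))

  open Characteristic2 F 1+1≡0 public

  ^q-+ : ∀ x y → (x + y) ^ q ≡ x ^ q + y ^ q
  ^q-+ = frobenius-+ (suc e)

  ^q^q : ∀ x → (x ^ q) ^ q ≡ x
  ^q^q x = trans (sym (^-* x q q)) (subst (λ n → x ^ n ≡ x) |F|≡q² (fermat x))

  Fq : Pred Carrier 0ℓ
  Fq t = t ^ q ≡ t

  Fq? : Decidable Fq
  Fq? t = t ^ q ≟ t

  Fq-+ : ∀ {a b} → Fq a → Fq b → Fq (a + b)
  Fq-+ {a} {b} a∈Fq b∈Fq = trans (^q-+ a b) (cong₂ _+_ a∈Fq b∈Fq)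

  Fq*? : Decidable (λ t → Fq t × ¬ t ≡ 0#)
  Fq*? t = Fq? t ×-dec nonzero? t

  count-Fq* : count Fq*? ≤ suc q-2
  count-Fq* = ℕ.≤-trans (count-mono Fq*? (λ t → t ^ suc q-2 ≟ 1#) tᵠ⁻¹≡1) (count[x^1+n≡c]≤1+n q-2 1≢0)
    where
    tᵠ⁻¹≡1 : ∀ t → Fq t × ¬ t ≡ 0# → t ^ suc q-2 ≡ 1#
    tᵠ⁻¹≡1 t (tᵠ≡t , t≢0) =
      *-cancelˡ t _ _ t≢0 (trans (subst (λ n → t ^ n ≡ t) q≡2+[q-2] tᵠ≡t) (sym (*-identityʳ t)))

  count-Fq : count Fq? ≤ q
  count-Fq = begin
    count Fq?                                        ≡⟨ count-split Fq? (_≟ 0#) ⟩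
    count (λ t → Fq? t ×-dec t ≟ 0#) +ℕ count Fq*?   ≤⟨ ℕ.+-mono-≤ (count-mono _ (_≟ 0#) (λ _ → proj₂)) count-Fq* ⟩
    count (_≟ 0#) +ℕ suc q-2                         ≡⟨ cong (_+ℕ suc q-2) (count-≟ 0#) ⟩
    suc (suc q-2)                                    ≡⟨ q≡2+[q-2] ⟨
    q                                                ∎
    where open ℕ.≤-Reasoning

  Fq-⁻¹ : ∀ {x} → Fq x → ¬ x ≡ 0# → Fq (x ⁻¹)
  Fq-⁻¹ {x} xᵠ≡x x≢0 = trans (⁻¹-unique (begin
    x * (x ⁻¹) ^ q        ≡⟨ cong (_* (x ⁻¹) ^ q) xᵠ≡x ⟨
    x ^ q * (x ⁻¹) ^ q    ≡⟨ ^-distrib-* x (x ⁻¹) q ⟨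
    (x * x ⁻¹) ^ q        ≡⟨ cong (_^ q) (⁻¹-inverseʳ x≢0) ⟩
    1# ^ q                ≡⟨ 1^ q ⟩
    1#                    ∎)) refl
    where open ≡-Reasoning

  norm trace : Carrier → Carrier
  norm w  = w ^ suc q
  trace y = y + y ^ q

  norm-Fq : ∀ w → Fq (norm w)
  norm-Fq w = begin
    (w ^ suc q) ^ q        ≡⟨ ^-* w (suc q) q ⟨
    w ^ (q +ℕ q *ℕ q)      ≡⟨ ^-+ w q (q *ℕ q) ⟩
    w ^ q * w ^ (q *ℕ q)   ≡⟨ cong (w ^ q *_) (trans (^-* w q q) (^q^q w)) ⟩
    w ^ q * w              ≡⟨ *-comm _ _ ⟩
    w * w ^ q              ∎
    where open ≡-Reasoning

  trace-Fq : ∀ y → Fq (trace y)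
  trace-Fq y = trans (^q-+ y (y ^ q)) (trans (cong (y ^ q +_) (^q^q y)) (+-comm _ _))

  norm≡0⇒≡0 : ∀ {w} → norm w ≡ 0# → w ≡ 0#
  norm≡0⇒≡0 = ^≡0⇒≡0 (suc q)

  norm-0 : norm 0# ≡ 0#
  norm-0 = zeroˡ _

  fibreSize-norm-0 : fibreSize norm 0# ≡ 1
  fibreSize-norm-0 = trans (count-cong _ (_≟ 0#) (λ w → mk⇔ norm≡0⇒≡0 (λ { refl → norm-0 }))) (count-≟ 0#)

  -- The q² - 1 nonzero elements of F fall into at most q - 1 norm fibres of size ≤ q + 1.
  fibreSize-norm : ∀ {t} → Fq t → ¬ t ≡ 0# → fibreSize norm t ≡ suc q
  fibreSize-norm {t} t∈Fq t≢0 = fibreSize-forced norm (Unique.filter⁺ Fq*? U!) count-Fq*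
    (λ s s∈ → count[x^1+n≡c]≤1+n q (proj₂ (proj₂ (∈-filter⁻ Fq*? {xs = U} s∈))))
    (ℕ.≤-reflexive total) t (∈-filter⁺ Fq*? (∈U t) (t∈Fq , t≢0))
    where
    norm∈Fq*⇔≢0 : ∀ w → norm w ∈ filter Fq*? U ⇔ (¬ w ≡ 0#)
    norm∈Fq*⇔≢0 w =
      mk⇔ (λ Nw∈ w≡0 → proj₂ (proj₂ (∈-filter⁻ Fq*? {xs = U} Nw∈)) (trans (cong norm w≡0) norm-0))
          (λ w≢0 → ∈-filter⁺ Fq*? (∈U (norm w)) (norm-Fq w , ^-≢0 (suc q) w≢0))
    total : suc q-2 *ℕ suc q ≡ count (λ w → norm w ∈? filter Fq*? U)
    total = ℕ.suc-injective (begin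
      suc (suc q-2 *ℕ suc q)                          ≡⟨ cong (λ n → suc (suc q-2 *ℕ suc n)) q≡2+[q-2] ⟩
      suc (suc q-2 *ℕ suc (suc (suc q-2)))            ≡⟨ [2+m]²≡1+[1+m][3+m] q-2 ⟨
      suc (suc q-2) *ℕ suc (suc q-2)                  ≡⟨ cong₂ _*ℕ_ q≡2+[q-2] q≡2+[q-2] ⟨
      q *ℕ q                                          ≡⟨ |F|≡q² ⟨
      length U                                        ≡⟨ order≡1+count-nonzero ⟩
      suc (count nonzero?)                            ≡⟨ cong suc (count-cong _ _ (λ w → ⇔.sym (norm∈Fq*⇔≢0 w))) ⟩
      suc (count (λ w → norm w ∈? filter Fq*? U))     ∎)
      where open ≡-Reasoning

  fibreSize-trace : ∀ {t} → Fq t → fibreSize trace t ≡ q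
  fibreSize-trace {t} t∈Fq = fibreSize-forced trace (Unique.filter⁺ Fq? U!) count-Fq
    (λ s _ → fibre≤q s) (ℕ.≤-reflexive total) t (∈-filter⁺ Fq? (∈U t) t∈Fq)
    where
    fibre≤q : ∀ s → fibreSize trace s ≤ q
    fibre≤q s with s ≟ 0#
    ... | yes refl = ℕ.≤-trans (count-mono _ Fq? (λ y y+yᵠ≡0 → sym (x+y≡0⇒x≡y y+yᵠ≡0))) count-Fq
    ... | no  s≢0  =
      subst (λ n → count (λ y → y + y ^ n ≟ s) ≤ n) (sym q≡2+[q-2]) (count[y+y^2+n≡t]≤2+n q-2 s≢0)
    total : q *ℕ q ≡ count (λ y → trace y ∈? filter Fq? U)
    total = trans (sym |F|≡q²) (sym (count-⊤ _ (λ y → ∈-filter⁺ Fq? (∈U (trace y)) (trace-Fq y))))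


module HermitianUnion (F : Field) (U : List (Field.Carrier F)) (U! : Unique U) (∈U : ∀ a → a ∈ U)
                      (e : ℕ) (|F|≡q² : length U ≡ 2 ^ℕ suc e *ℕ 2 ^ℕ suc e)
                      (Λ : List (Field.Carrier F)) (Λ! : Unique Λ)
                      (Λ⊆Fq : ∀ v → v ∈ Λ → FieldOfOrderSquare.Fq F U U! ∈U e |F|≡q² v) where

  open Field F
  open Geometry F
  open FieldOfOrderSquare F U U! ∈U e |F|≡q²

  0^q : 0# ^ q ≡ 0#
  0^q = subst (λ n → 0# ^ n ≡ 0#) (sym q≡2+[q-2]) (zeroˡ _)

  onU-pt₁ : ∀ λ′ y z → onU q λ′ (pt₁ y z) ⇔ λ′ ≡ trace y + norm z
  onU-pt₁ λ′ y z = mk⇔ (λ on → x+y≡0⇒x≡y (trans (sym equation) on))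
                       (λ λ′≡ → trans equation (trans (cong (_+ (trace y + norm z)) λ′≡) (x+x≡0 _)))
    where
    equation : λ′ * (1# ^ suc q) + (1# ^ q) * y + 1# * (y ^ q) + (z ^ suc q) ≡ λ′ + (trace y + norm z)
    equation = begin
      λ′ * (1# ^ suc q) + (1# ^ q) * y + 1# * (y ^ q) + norm z
        ≡⟨ cong₂ (λ u v → λ′ * u + v * y + 1# * (y ^ q) + norm z) (1^ (suc q)) (1^ q) ⟩
      λ′ * 1# + 1# * y + 1# * (y ^ q) + norm z
        ≡⟨ solve 4 (λ l y yᵠ n → l :* con 1 :+ con 1 :* y :+ con 1 :* yᵠ :+ n := l :+ ((y :+ yᵠ) :+ n))
                   refl λ′ y (y ^ q) (norm z) ⟩
      λ′ + (trace y + norm z)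
        ∎
      where open ≡-Reasoning

  onU-pt₂ : ∀ λ′ z → onU q λ′ (pt₂ z) → z ≡ 0#
  onU-pt₂ λ′ z on = norm≡0⇒≡0 (trans (sym equation) on)
    where
    equation : λ′ * (0# ^ suc q) + (0# ^ q) * 1# + 0# * (1# ^ q) + (z ^ suc q) ≡ norm z
    equation = begin
      λ′ * (0# ^ suc q) + (0# ^ q) * 1# + 0# * (1# ^ q) + norm z
        ≡⟨ cong₂ (λ u v → λ′ * u + v * 1# + 0# * (1# ^ q) + norm z) (zeroˡ _) 0^q ⟩
      λ′ * 0# + 0# * 1# + 0# * (1# ^ q) + norm z
        ≡⟨ solve 3 (λ l n o → l :* con 0 :+ con 0 :* con 1 :+ con 0 :* o :+ n := n) refl λ′ (norm z) (1# ^ q) ⟩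
      norm z
        ∎
      where open ≡-Reasoning

  ¬onU-pt₃ : ∀ λ′ → ¬ onU q λ′ pt₃
  ¬onU-pt₃ λ′ on = 1≢0 (trans (sym equation) on)
    where
    equation : λ′ * (0# ^ suc q) + (0# ^ q) * 0# + 0# * (0# ^ q) + (1# ^ suc q) ≡ 1#
    equation = begin
      λ′ * (0# ^ suc q) + (0# ^ q) * 0# + 0# * (0# ^ q) + (1# ^ suc q)
        ≡⟨ cong₂ (λ u v → λ′ * u + (0# ^ q) * 0# + 0# * (0# ^ q) + v) (zeroˡ _) (1^ (suc q)) ⟩
      λ′ * 0# + (0# ^ q) * 0# + 0# * (0# ^ q) + 1#
        ≡⟨ solve 2 (λ l o → l :* con 0 :+ o :* con 0 :+ con 0 :* o :+ con 1 := con 1) refl λ′ (0# ^ q) ⟩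
      1#
        ∎
      where open ≡-Reasoning

  InUnion : Point → Set
  InUnion p = ¬ p ≡ U₂ × ∃ λ λ′ → λ′ ∈ Λ × onU q λ′ p

  InUnion-pt₁ : ∀ y z → InUnion (pt₁ y z) ⇔ trace y + norm z ∈ Λ
  InUnion-pt₁ y z = mk⇔ (λ (_ , λ′ , λ′∈Λ , on) → subst (_∈ Λ) (Equivalence.to (onU-pt₁ λ′ y z) on) λ′∈Λ)
                        (λ level∈Λ → (λ ()) , _ , level∈Λ , Equivalence.from (onU-pt₁ _ y z) refl)

  InUnion-affine : ∀ {p} → InUnion p → ∃₂ λ y z → p ≡ pt₁ y z
  InUnion-affine {pt₁ y z} _                    = y , z , refl
  InUnion-affine {pt₂ z}   (p≢U₂ , λ′ , _ , on) = ⊥-elim (p≢U₂ (cong pt₂ (onU-pt₂ λ′ z on)))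
  InUnion-affine {pt₃}     (_ , λ′ , _ , on)    = ⊥-elim (¬onU-pt₃ λ′ on)

  fibreSize-+ : ∀ f c v → fibreSize (λ w → f w + c) v ≡ fibreSize f (v + c)
  fibreSize-+ f c v = count-cong _ _ (λ w → mk⇔ x+y≡z⇒x≡z+y (λ fw≡v+c → trans (cong (_+ c) fw≡v+c) (x+y+y≡x v c)))

  count-trace+c∈Λ : ∀ {c} → Fq c → count (λ y → trace y + c ∈? Λ) ≡ length Λ *ℕ q
  count-trace+c∈Λ {c} c∈Fq = trans (count-preimage (λ y → trace y + c) Λ!)
    (sum-map-const _ Λ (λ v v∈Λ → trans (fibreSize-+ trace c v) (fibreSize-trace (Fq-+ (Λ⊆Fq v v∈Λ) c∈Fq))))

  fibreSize-norm+c : ∀ {c v} → Fq c → v ∈ Λ → ¬ v ≡ c → fibreSize (λ w → norm w + c) v ≡ suc q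
  fibreSize-norm+c {c} {v} c∈Fq v∈Λ v≢c =
    trans (fibreSize-+ norm c v) (fibreSize-norm (Fq-+ (Λ⊆Fq v v∈Λ) c∈Fq) (v≢c ∘ x+y≡0⇒x≡y))

  count-norm+c∈Λ-∉ : ∀ {c} → Fq c → ¬ c ∈ Λ → count (λ w → norm w + c ∈? Λ) ≡ length Λ *ℕ suc q
  count-norm+c∈Λ-∉ {c} c∈Fq c∉Λ = trans (count-preimage (λ w → norm w + c) Λ!)
    (sum-map-const _ Λ (λ v v∈Λ → fibreSize-norm+c c∈Fq v∈Λ (λ { refl → c∉Λ v∈Λ })))

  -- Only the fibre over c itself, which is {0}, fails to have size q + 1.
  count-norm+c∈Λ-∈ : ∀ {c} → Fq c → c ∈ Λ → count (λ w → norm w + c ∈? Λ) +ℕ suc q ≡ suc (length Λ *ℕ suc q)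
  count-norm+c∈Λ-∈ {c} c∈Fq c∈Λ = begin
    count (λ w → norm w + c ∈? Λ) +ℕ suc q
      ≡⟨ cong (_+ℕ suc q) (count-preimage (λ w → norm w + c) Λ!) ⟩
    sum (map (fibreSize (λ w → norm w + c)) Λ) +ℕ suc q
      ≡⟨ sum-map-const-except _ Λ Λ! c∈Λ (λ v v∈Λ → fibreSize-norm+c c∈Fq v∈Λ) ⟩
    fibreSize (λ w → norm w + c) c +ℕ length Λ *ℕ suc q
      ≡⟨ cong (_+ℕ length Λ *ℕ suc q) fibre-over-c ⟩
    suc (length Λ *ℕ suc q)
      ∎
    where
    open ≡-Reasoning
    fibre-over-c : fibreSize (λ w → norm w + c) c ≡ 1
    fibre-over-c = trans (fibreSize-+ norm c c) (trans (cong (fibreSize norm) (x+x≡0 c)) fibreSize-norm-0)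

  perp-pt₁ : ∀ y₀ z₀ y z → pt₁ y z onLine perp q (pt₁ y₀ z₀) ⇔ y ≡ y₀ ^ q + z₀ ^ q * z
  perp-pt₁ y₀ z₀ y z = mk⇔ (λ on → x+y≡0⇒x≡y (trans (sym equation) on))
                           (λ y≡ → trans equation (trans (cong (_+ (y₀ ^ q + z₀ ^ q * z)) y≡) (x+x≡0 _)))
    where
    equation : y₀ ^ q * 1# + 1# ^ q * y + z₀ ^ q * z ≡ y + (y₀ ^ q + z₀ ^ q * z)
    equation = begin
      y₀ ^ q * 1# + 1# ^ q * y + z₀ ^ q * z   ≡⟨ cong (λ u → y₀ ^ q * 1# + u * y + z₀ ^ q * z) (1^ q) ⟩
      y₀ ^ q * 1# + 1# * y + z₀ ^ q * z       ≡⟨ solve 3 (λ a y b → a :* con 1 :+ con 1 :* y :+ b := y :+ (a :+ b))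
                                                          refl (y₀ ^ q) y (z₀ ^ q * z) ⟩
      y + (y₀ ^ q + z₀ ^ q * z)               ∎
      where open ≡-Reasoning

  perp-pt₂ : ∀ z₀ y z → pt₁ y z onLine perp q (pt₂ z₀) ⇔ z₀ ^ q * z ≡ 1#
  perp-pt₂ z₀ y z = mk⇔ (λ on → sym (x+y≡0⇒x≡y (trans (sym equation) on)))
                        (λ z₀ᵠz≡1 → trans equation (trans (cong (1# +_) z₀ᵠz≡1) 1+1≡0))
    where
    equation : 1# ^ q * 1# + 0# ^ q * y + z₀ ^ q * z ≡ 1# + z₀ ^ q * z
    equation = begin
      1# ^ q * 1# + 0# ^ q * y + z₀ ^ q * z   ≡⟨ cong₂ (λ u v → u * 1# + v * y + z₀ ^ q * z) (1^ q) 0^q ⟩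
      1# * 1# + 0# * y + z₀ ^ q * z           ≡⟨ solve 2 (λ y b → con 1 :* con 1 :+ con 0 :* y :+ b := con 1 :+ b)
                                                          refl y (z₀ ^ q * z) ⟩
      1# + z₀ ^ q * z                         ∎
      where open ≡-Reasoning

  perp-pt₃ : ∀ y z → pt₁ y z onLine perp q pt₃ ⇔ z ≡ 0#
  perp-pt₃ y z = mk⇔ (trans (sym equation)) (trans equation)
    where
    equation : 0# ^ q * 1# + 0# ^ q * y + 1# ^ q * z ≡ z
    equation = begin
      0# ^ q * 1# + 0# ^ q * y + 1# ^ q * z   ≡⟨ cong₂ (λ u v → u * 1# + u * y + v * z) 0^q (1^ q) ⟩
      0# * 1# + 0# * y + 1# * z               ≡⟨ solve 2 (λ y z → con 0 :* con 1 :+ con 0 :* y :+ con 1 :* z := z) refl y z ⟩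
      z                                       ∎
      where open ≡-Reasoning

  perp-U₂ : ∀ y z → ¬ pt₁ y z onLine perp q U₂
  perp-U₂ y z on = 1≢0 (trans (sym (Equivalence.to (perp-pt₂ 0# y z) on)) (trans (cong (_* z) 0^q) (zeroˡ z)))

  trace+norm-on-perp : ∀ y₀ z₀ z → trace (y₀ ^ q + z₀ ^ q * z) + norm z ≡ norm (z + z₀) + (trace y₀ + norm z₀)
  trace+norm-on-perp y₀ z₀ z = begin
    g + g ^ q + z * z ^ q
      ≡⟨ cong (λ u → g + u + z * z ^ q) gᵠ≡ ⟩
    g + (y₀ + z₀ * z ^ q) + z * z ^ q
      ≡⟨ +-identityʳ _ ⟨
    g + (y₀ + z₀ * z ^ q) + z * z ^ q + 0#
      ≡⟨ cong (g + (y₀ + z₀ * z ^ q) + z * z ^ q +_) (x+x≡0 (z₀ * z₀ ^ q)) ⟨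
    (y₀ ^ q + z₀ ^ q * z) + (y₀ + z₀ * z ^ q) + z * z ^ q + (z₀ * z₀ ^ q + z₀ * z₀ ^ q)
      ≡⟨ solve 6 (λ a A z Z b B → (A :+ B :* z) :+ (a :+ b :* Z) :+ z :* Z :+ (b :* B :+ b :* B)
                                  := (z :+ b) :* (Z :+ B) :+ ((a :+ A) :+ b :* B)) refl y₀ (y₀ ^ q) z (z ^ q) z₀ (z₀ ^ q) ⟩
    (z + z₀) * (z ^ q + z₀ ^ q) + (trace y₀ + norm z₀)
      ≡⟨ cong (λ u → (z + z₀) * u + (trace y₀ + norm z₀)) (^q-+ z z₀) ⟨
    norm (z + z₀) + (trace y₀ + norm z₀)
      ∎
    where
    open ≡-Reasoning
    g : Carrier
    g = y₀ ^ q + z₀ ^ q * z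
    gᵠ≡ : g ^ q ≡ y₀ + z₀ * z ^ q
    gᵠ≡ = trans (^q-+ _ _) (cong₂ _+_ (^q^q y₀) (trans (^-distrib-* _ _ q) (cong (_* z ^ q) (^q^q z₀))))

  Perp∩Σ : Point → Point → Set
  Perp∩Σ x p = p onLine perp q x × InUnion p

  HasCard-horizontal : ∀ x z₀ → (∀ y z → pt₁ y z onLine perp q x ⇔ z ≡ z₀) → HasCard (Perp∩Σ x) (length Λ *ℕ q)
  HasCard-horizontal x z₀ on⇔ = subst (HasCard (Perp∩Σ x)) (count-trace+c∈Λ (norm-Fq z₀))
    (HasCard-image (λ y → trace y + norm z₀ ∈? Λ) (λ y → pt₁ y z₀) (cong Y) on-line
                   (λ y level∈Λ → Equivalence.from (on⇔ y z₀) refl , Equivalence.from (InUnion-pt₁ y z₀) level∈Λ))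
    where
    on-line : ∀ p → Perp∩Σ x p → ∃ λ y → trace y + norm z₀ ∈ Λ × p ≡ pt₁ y z₀
    on-line p (on , p∈Σ) with y , z , refl ← InUnion-affine p∈Σ with refl ← Equivalence.to (on⇔ y z) on =
      y , Equivalence.to (InUnion-pt₁ y z) p∈Σ , refl

  HasCard-Perp∩Σ-pt₁ : ∀ y₀ z₀ → HasCard (Perp∩Σ (pt₁ y₀ z₀)) (count (λ w → norm w + (trace y₀ + norm z₀) ∈? Λ))
  HasCard-Perp∩Σ-pt₁ y₀ z₀ = subst (HasCard (Perp∩Σ (pt₁ y₀ z₀))) count-shift
    (HasCard-image C? φ (cong Z) on-line
                   (λ z C → Equivalence.from (perp-pt₁ y₀ z₀ (g z) z) refl , Equivalence.from (InUnion-pt₁ (g z) z) C))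
    where
    c₀ : Carrier
    c₀ = trace y₀ + norm z₀
    g : Carrier → Carrier
    g z = y₀ ^ q + z₀ ^ q * z
    φ : Carrier → Point
    φ z = pt₁ (g z) z
    C? : Decidable (λ z → trace (g z) + norm z ∈ Λ)
    C? z = trace (g z) + norm z ∈? Λ
    on-line : ∀ p → Perp∩Σ (pt₁ y₀ z₀) p → ∃ λ z → trace (g z) + norm z ∈ Λ × p ≡ φ z
    on-line p (on , p∈Σ) with y , z , refl ← InUnion-affine p∈Σ with refl ← Equivalence.to (perp-pt₁ y₀ z₀ y z) on =
      z , Equivalence.to (InUnion-pt₁ _ z) p∈Σ , refl
    count-shift : count C? ≡ count (λ w → norm w + c₀ ∈? Λ)
    count-shift = trans (count-cong C? (λ z → norm (z + z₀) + c₀ ∈? Λ)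
                                    (λ z → mk⇔ (subst (_∈ Λ) (trace+norm-on-perp y₀ z₀ z))
                                               (subst (_∈ Λ) (sym (trace+norm-on-perp y₀ z₀ z)))))
                        (count-∘-bijection (λ w → norm w + c₀ ∈? Λ) (_+ z₀) (_+ z₀) (λ w → x+y+y≡x w z₀)
                                                                                    (λ w → x+y+y≡x w z₀))

  card-Perp∩Σ-inside : ∀ x {n} → InUnion x → n +ℕ suc q ≡ suc (length Λ *ℕ suc q) → HasCard (Perp∩Σ x) n
  card-Perp∩Σ-inside (pt₁ y₀ z₀) {n} x∈Σ n+q+1≡ =
    subst (HasCard (Perp∩Σ (pt₁ y₀ z₀))) count≡n (HasCard-Perp∩Σ-pt₁ y₀ z₀)
    where
    count≡n : count (λ w → norm w + (trace y₀ + norm z₀) ∈? Λ) ≡ n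
    count≡n = ℕ.+-cancelʳ-≡ (suc q) _ _ (trans (count-norm+c∈Λ-∈ (Fq-+ (trace-Fq y₀) (norm-Fq z₀))
                                                                (Equivalence.to (InUnion-pt₁ y₀ z₀) x∈Σ))
                                               (sym n+q+1≡))
  card-Perp∩Σ-inside (pt₂ _) x∈Σ _ with () ← InUnion-affine x∈Σ
  card-Perp∩Σ-inside pt₃     x∈Σ _ with () ← InUnion-affine x∈Σ

  card-Perp∩Σ-outside : ∀ x → ¬ InUnion x → ¬ onℓ x → HasCard (Perp∩Σ x) (length Λ *ℕ suc q)
  card-Perp∩Σ-outside (pt₁ y₀ z₀) x∉Σ _ = subst (HasCard (Perp∩Σ (pt₁ y₀ z₀)))
    (count-norm+c∈Λ-∉ (Fq-+ (trace-Fq y₀) (norm-Fq z₀)) (x∉Σ ∘ Equivalence.from (InUnion-pt₁ y₀ z₀)))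
    (HasCard-Perp∩Σ-pt₁ y₀ z₀)
  card-Perp∩Σ-outside (pt₂ _) _ x∉ℓ = ⊥-elim (x∉ℓ refl)
  card-Perp∩Σ-outside pt₃     _ x∉ℓ = ⊥-elim (x∉ℓ refl)

  card-Perp∩Σ-ℓ : ∀ x → onℓ x → ¬ x ≡ U₂ → HasCard (Perp∩Σ x) (length Λ *ℕ q)
  card-Perp∩Σ-ℓ (pt₁ _ _) 1≡0 _    = ⊥-elim (1≢0 1≡0)
  card-Perp∩Σ-ℓ (pt₂ z₀)  _   x≢U₂ =
    HasCard-horizontal (pt₂ z₀) ((z₀ ^ q) ⁻¹) (λ y z → ⇔.trans (perp-pt₂ z₀ y z) (mk⇔ ⁻¹-unique z≡inverse))
    where
    z₀ᵠ≢0 : ¬ z₀ ^ q ≡ 0#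
    z₀ᵠ≢0 = ^-≢0 q (λ z₀≡0 → x≢U₂ (cong pt₂ z₀≡0))
    z≡inverse : ∀ {z} → z ≡ (z₀ ^ q) ⁻¹ → z₀ ^ q * z ≡ 1#
    z≡inverse refl = ⁻¹-inverseʳ z₀ᵠ≢0
  card-Perp∩Σ-ℓ pt₃       _   _    = HasCard-horizontal pt₃ 0# perp-pt₃

  card-Perp∩Σ-U₂ : HasCard (Perp∩Σ U₂) 0
  card-Perp∩Σ-U₂ = HasCard-∅ nothing-on-U₂
    where
    nothing-on-U₂ : ∀ p → ¬ Perp∩Σ U₂ p
    nothing-on-U₂ p (on , p∈Σ) with y , z , refl ← InUnion-affine p∈Σ = perp-U₂ y z on

module SubgroupLevels (F : Field) (U : List (Field.Carrier F)) (U! : Unique U) (∈U : ∀ a → a ∈ U)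
                      (e : ℕ) (|F|≡q² : length U ≡ 2 ^ℕ suc e *ℕ 2 ^ℕ suc e)
                      (H : Field.Carrier F → Set) (hs : List (Field.Carrier F)) (hs! : Unique hs)
                      (hs⇔H : ∀ h → h ∈ hs ⇔ H h)
                      (H⊆Fq : ∀ h → H h → FieldOfOrderSquare.Fq F U U! ∈U e |F|≡q² h) (1∉H : ¬ H (Field.1# F)) where

  open Field F
  open Geometry F
  open FieldOfOrderSquare F U U! ∈U e |F|≡q²

  level : Carrier → Carrier
  level h = (h + 1#) ⁻¹

  Λ : List Carrier
  Λ = map level hs

  level-injective : ∀ {h h′} → level h ≡ level h′ → h ≡ h′
  level-injective {h} {h′} eq =
    +-cancelʳ 1# h h′ (trans (sym (⁻¹-involutive _)) (trans (cong _⁻¹ eq) (⁻¹-involutive _)))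

  Λ! : Unique Λ
  Λ! = Unique.map⁺ level-injective hs!

  h+1≢0 : ∀ {h} → H h → ¬ h + 1# ≡ 0#
  h+1≢0 Hh h+1≡0 = 1∉H (subst H (x+y≡0⇒x≡y h+1≡0) Hh)

  Λ⊆Fq : ∀ v → v ∈ Λ → Fq v
  Λ⊆Fq v v∈Λ with h , h∈hs , refl ← ∈-map⁻ level v∈Λ =
    Fq-⁻¹ (Fq-+ (H⊆Fq h Hh) (1^ q)) (h+1≢0 Hh)
    where
    Hh : H h
    Hh = Equivalence.to (hs⇔H h) h∈hs

  open HermitianUnion F U U! ∈U e |F|≡q² Λ Λ! Λ⊆Fq public

  inΣ⇔InUnion : ∀ p → inΣ q H p ⇔ InUnion p
  inΣ⇔InUnion p = mk⇔ to from
    where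
    to : inΣ q H p → InUnion p
    to (p≢U₂ , h , Hh , λ′ , λ′[h+1]≡1 , on) = p≢U₂ , λ′ , λ′∈Λ , on
      where
      λ′∈Λ : λ′ ∈ Λ
      λ′∈Λ = subst (_∈ Λ) (sym (⁻¹-unique (trans (*-comm _ λ′) λ′[h+1]≡1)))
                   (∈-map⁺ level (Equivalence.from (hs⇔H h) Hh))
    from : InUnion p → inΣ q H p
    from (p≢U₂ , λ′ , λ′∈Λ , on) with h , h∈hs , refl ← ∈-map⁻ level λ′∈Λ =
      p≢U₂ , h , Hh , level h , trans (*-comm _ (h + 1#)) (⁻¹-inverseʳ (h+1≢0 Hh)) , on
      where
      Hh : H h
      Hh = Equivalence.to (hs⇔H h) h∈hs

  HasCard-Perp∩inΣ : ∀ x {n} → HasCard (Perp∩Σ x) n → HasCard (λ p → p onLine perp q x × inΣ q H p) n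
  HasCard-Perp∩inΣ x =
    HasCard-⇔ (λ p → mk⇔ (map₂ (Equivalence.from (inΣ⇔InUnion p))) (map₂ (Equivalence.to (inΣ⇔InUnion p))))

corollary1 : (F : Field) → let open Field F in let open Geometry F in
  (q e : ℕ) → q ≡ 2 ^ℕ suc e →
  HasCard {Carrier} (λ _ → ⊤) (q *ℕ q) →
  (H : Carrier → Set) →
  H 0# → (∀ x y → H x → H y → H (x + y)) → (∀ x → H x → H (- x)) →
  (∀ x → H x → x ^ q ≡ x) →
  HasCard H (q / 2) →
  ¬ H 1# →
  (x : Point) →
    (inΣ q H x → HasCard (λ p → p onLine perp q x × inΣ q H p) ((q *ℕ q ∸ q) / 2))
    × (¬ inΣ q H x → ¬ onℓ x → HasCard (λ p → p onLine perp q x × inΣ q H p) ((q *ℕ q +ℕ q) / 2))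
    × (onℓ x → ¬ x ≡ U₂ → HasCard (λ p → p onLine perp q x × inΣ q H p) ((q *ℕ q) / 2))
    × (x ≡ U₂ → HasCard (λ p → p onLine perp q x × inΣ q H p) 0)
corollary1 F q e refl (U , U! , U⇔⊤ , |F|≡q²) H _ _ _ H⊆Fq (hs , hs! , hs⇔H , |H|≡q/2) 1∉H x =
    (λ x∈Σ → transfer refl (card-Perp∩Σ-inside x (to x∈Σ) inside))
  , (λ x∉Σ x∉ℓ → transfer outside (card-Perp∩Σ-outside x (x∉Σ ∘ from) x∉ℓ))
  , (λ x∈ℓ x≢U₂ → transfer on-ℓ (card-Perp∩Σ-ℓ x x∈ℓ x≢U₂))
  , (λ { refl → transfer refl card-Perp∩Σ-U₂ })
  where
  open Field F
  open Geometry F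
  open SubgroupLevels F U U! (λ a → Equivalence.from (U⇔⊤ a) tt) e |F|≡q² H hs hs! hs⇔H H⊆Fq 1∉H
  open Equivalence (inΣ⇔InUnion x)
  k : ℕ
  k = 2 ^ℕ e
  |Λ|≡k : length Λ ≡ k
  |Λ|≡k = trans (List.length-map level hs) (trans |H|≡q/2 (2k/2≡k k))
  inside : (q *ℕ q ∸ q) / 2 +ℕ suc q ≡ suc (length Λ *ℕ suc q)
  inside = subst (λ m → (q *ℕ q ∸ q) / 2 +ℕ suc q ≡ suc (m *ℕ suc q)) (sym |Λ|≡k) ([q²-q]/2+q+1≡1+k[q+1] k)
  outside : length Λ *ℕ suc q ≡ (q *ℕ q +ℕ q) / 2
  outside = trans (cong (_*ℕ suc q) |Λ|≡k) (sym ([q²+q]/2≡k[q+1] k))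
  on-ℓ : length Λ *ℕ q ≡ (q *ℕ q) / 2
  on-ℓ = trans (cong (_*ℕ q) |Λ|≡k) (sym (q²/2≡kq k))
  transfer : ∀ {m n} → m ≡ n → HasCard (Perp∩Σ x) m → HasCard (λ p → p onLine perp q x × inΣ q H p) n
  transfer refl = HasCard-Perp∩inΣ x
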